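{- Let $\Phi$ be the root system of a connected, simply connected, simple complex Lie group, with Weyl group $W$. If $\alpha,\beta\in\tilde{\Phi}^+$ satisfy $l(s_\alpha s_\beta)=l(s_\alpha)+l(s_\beta)$ and $s_\alpha s_\beta\neq s_\beta s_\alpha$, then $\alpha(\beta^\vee)<0$.
   Context: The root system lives in $\mathfrak{t}^*$ where $\mathfrak{t}$ carries a $W$-invariant inner product $\langle\cdot,\cdot\rangle$ identifying $\mathfrak{t}$ with $\mathfrak{t}^*$; the coroot of $\alpha$ is $\alpha^\vee=2\alpha/\langle\alpha,\alpha\rangle$. With simple roots $\alpha_1,\dots,\alpha_l$ and simple coroots $\alpha_i^\vee$, $s_i=s_{\alpha_i}$ are the simple reflections and $l(w)$ is the length of $w\in W$ with respect to them. For $\alpha\in\Phi^+$ write $\alpha^\vee=m_1\alpha_1^\vee+\dots+m_l\alpha_l^\vee$ with nonnegative integers $m_i$ and set ${\rm ht}(\alpha^\vee)=\sum m_i$. $\tilde{\Phi}^+$ denotes the set of positive roots $\alpha$ with $l(s_\alpha)=2{\rm ht}(\alpha^\vee)-1$. -}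

module Defs where

open import Data.Nat using (ℕ; suc)
import Data.Nat
open import Data.Fin using (Fin; zero; suc; _≟_)
open import Data.Integer using (ℤ; +_; _+_; _-_; _*_; _≤_; _<_)
open import Data.List using (List; []; _∷_; length)
open import Data.Bool using (Bool; true; false)
open import Data.Product using (Σ; ∃; ∃-syntax; _×_)
open import Relation.Nullary using (¬_; yes; no)
open import Relation.Binary.PropositionalEquality using (_≡_; _≢_)

∑ : ∀ {n} → (Fin n → ℤ) → ℤ
∑ {ℕ.zero} f = + 0
∑ {suc n} f = f zero + ∑ (λ i → f (suc i))

-- Vectors in the root lattice (coordinates w.r.t. simple roots) or in the
-- coroot lattice (coordinates w.r.t. simple coroots).
Lat : ℕ → Set
Lat l = Fin l → ℤ

_≗ᴸ_ : ∀ {l} → Lat l → Lat l → Set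
x ≗ᴸ y = ∀ i → x i ≡ y i

e : ∀ {l} → Fin l → Lat l
e i j with j ≟ i
... | yes _ = + 1
... | no _ = + 0

-- Data of a root system of a simple complex Lie algebra, given by a basis of
-- simple roots: Cartan matrix A with  A i j = α_j(α_i^∨) = 2⟨α_i,α_j⟩/⟨α_i,α_i⟩,
-- and the W-invariant inner product on simple roots ⟨α_i,α_j⟩ = d i * A i j
-- (so d i = ⟨α_i,α_i⟩/2, up to an overall positive scalar, irrelevant below).
-- Conditions: generalized Cartan matrix, symmetrizable by d, positive definite
-- (finite type), indecomposable (simple), rank ≥ 1.
record CartanDatum (l : ℕ) : Set where
  field
    A : Fin l → Fin l → ℤ
    d : Fin l → ℤ
    rank-pos : Fin l
    diag : ∀ i → A i i ≡ + 2
    offdiag : ∀ i j → i ≢ j → A i j ≤ + 0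
    d-pos : ∀ i → + 0 < d i
    symm : ∀ i j → d i * A i j ≡ d j * A j i
    posdef : ∀ (x : Lat l) → (∃[ i ] (x i ≢ + 0)) →
             + 0 < ∑ (λ i → ∑ (λ j → x i * d i * A i j * x j))
    indecomposable : ∀ (S : Fin l → Bool) → (∃[ i ] (S i ≡ true)) →
             (∃[ j ] (S j ≡ false)) →
             ∃[ i ] ∃[ j ] (S i ≡ true × S j ≡ false × A i j ≢ + 0)

module _ {l : ℕ} (C : CartanDatum l) where
  open CartanDatum C

  ⟪_,_⟫ : Lat l → Lat l → ℤ
  ⟪ x , y ⟫ = ∑ (λ i → ∑ (λ j → x i * d i * A i j * y j))

  -- Evaluation of x (in root lattice) on h (in coroot lattice): x(h).
  pair : Lat l → Lat l → ℤ
  pair x h = ∑ (λ i → h i * ∑ (λ j → x j * A i j))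

  sref : Fin l → Lat l → Lat l
  sref i x j = x j - pair x (e i) * e i j

  act : List (Fin l) → Lat l → Lat l
  act [] x = x
  act (i ∷ w) x = sref i (act w x)

  IsRoot : Lat l → Set
  IsRoot α = ∃[ w ] ∃[ i ] (α ≗ᴸ act w (e i))

  IsPosRoot : Lat l → Set
  IsPosRoot α = IsRoot α × (∀ i → + 0 ≤ α i)

  -- m is the coroot α^∨ = 2α/⟨α,α⟩ written in the basis of simple coroots
  -- α_i^∨ = α_i / d i :  m i = 2 α_i d_i / ⟨α,α⟩.
  IsCorootOf : Lat l → Lat l → Set
  IsCorootOf α m = ∀ i → m i * ⟪ α , α ⟫ ≡ + 2 * α i * d i

  ht : Lat l → ℤ
  ht m = ∑ m

  refl : Lat l → Lat l → Lat l → Lat l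
  refl α m x j = x j - pair x m * α j

  HasLength : (Lat l → Lat l) → ℕ → Set
  HasLength f k =
    (∃[ w ] (length w ≡ k × (∀ x → act w x ≗ᴸ f x))) ×
    (∀ w → (∀ x → act w x ≗ᴸ f x) → k Data.Nat.≤ length w)

  -- α ∈ Φ̃⁺ (with coroot coefficients m): positive root with
  -- l(s_α) = 2 ht(α^∨) - 1.
  InTildePos : Lat l → Lat l → Set
  InTildePos α m = IsPosRoot α × IsCorootOf α m ×
    ∃[ k ] (HasLength (refl α m) k × + k ≡ + 2 * ht m - + 1)

module Submission where

-- If α(β^∨) = 0 the reflections s_α and s_β commute, so assume α(β^∨) > 0 and put γ = s_β α; we show
-- l(s_α s_β) < l(s_α) + l(s_β). Every root is nonnegative or nonpositive: if a coordinate v_j of a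
-- root v has sign opposite to all other coordinates, integrality of the coroot gives
-- ⟨v,v⟩ ≤ v_j² ⟨α_j,α_j⟩, whereas positive definiteness and A_jk ≤ 0 give ⟨v,v⟩ > v_j² ⟨α_j,α_j⟩
-- unless v is a multiple of α_j. If γ < 0, the exchange condition deletes a letter from a word for
-- s_β s_α of length l(s_β), and s_α s_β is its inverse. If γ > 0, then s_α s_β = s_β s_γ with
-- γ^∨ = α^∨ - β(α^∨) β^∨, and conjugating by simple reflections gives l(s_γ) ≤ 2 ht(γ^∨) - 1 for
-- every positive root γ, hence l(s_α s_β) ≤ l(s_β) + 2 ht(α^∨) - 2 β(α^∨) ht(β^∨) - 1 < l(s_β) + l(s_α).

open import Data.Empty using (⊥-elim)
open import Data.Fin using (Fin; zero; suc; _≟_)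
open import Data.Fin.Properties using (suc-injective; any?)
open import Data.Integer hiding (suc; _≟_)
open import Data.Integer.Properties renaming (_≟_ to _≟ℤ_)
open import Data.Integer.Tactic.RingSolver using (solve-∀)
open import Data.List using (List; []; _∷_; _++_; [_]; length; reverse)
open import Data.List.Properties using (length-++; length-reverse; unfold-reverse)
open import Data.Nat as ℕ using (ℕ)
import Data.Nat.Properties as ℕ
open import Data.Product using (∃-syntax; _×_; _,_; proj₁; proj₂)
open import Data.Sum as Sum using (_⊎_; inj₁; inj₂)
open import Function using (_∘_)
open import Relation.Binary.Definitions using (Tri; tri<; tri≈; tri>)
open import Relation.Binary.PropositionalEquality using (_≡_; _≢_; ≢-sym; refl; sym; trans; cong; cong₂; subst; subst₂; module ≡-Reasoning)
open ≡-Reasoning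
open import Relation.Nullary using (¬_; Dec; yes; no; ¬?; _×-dec_)

open import Defs hiding (refl)
import Defs as D

nonPos*nonPos⇒nonNeg : ∀ {a b} → a ≤ 0ℤ → b ≤ 0ℤ → 0ℤ ≤ a * b
nonPos*nonPos⇒nonNeg {a} {b} a≤0 b≤0 = subst (_≤ a * b) (*-zeroʳ a) (*-monoˡ-≤-nonPos a {{nonPositive a≤0}} b≤0)

pos*pos⇒pos : ∀ {a b} → 0ℤ < a → 0ℤ < b → 0ℤ < a * b
pos*pos⇒pos {a} {b} 0<a 0<b = subst (_< a * b) (*-zeroʳ a) (*-monoˡ-<-pos a {{positive 0<a}} 0<b)

pos*⇒pos : ∀ {a b} → 0ℤ < b → 0ℤ < a * b → 0ℤ < a
pos*⇒pos {b = b} 0<b = *-cancelʳ-<-nonNeg b {{nonNegative (<⇒≤ 0<b)}}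

nonNeg*pos⇒pos : ∀ {a b} → 0ℤ ≤ a → 0ℤ < a * b → 0ℤ < b
nonNeg*pos⇒pos {a} {b} 0≤a 0<ab = *-cancelˡ-<-nonNeg a {{nonNegative 0≤a}} (subst (_< a * b) (sym (*-zeroʳ a)) 0<ab)

nonNeg*nonNeg⇒nonNeg : ∀ {a b} → 0ℤ ≤ a → 0ℤ ≤ b → 0ℤ ≤ a * b
nonNeg*nonNeg⇒nonNeg {a} {b} 0≤a 0≤b = subst (_≤ a * b) (*-zeroʳ a) (*-monoˡ-≤-nonNeg a {{nonNegative 0≤a}} 0≤b)

nonNeg*nonPos⇒nonPos : ∀ {a b} → 0ℤ ≤ a → b ≤ 0ℤ → a * b ≤ 0ℤ
nonNeg*nonPos⇒nonPos {a} {b} 0≤a b≤0 = subst (a * b ≤_) (*-zeroʳ a) (*-monoˡ-≤-nonNeg a {{nonNegative 0≤a}} b≤0)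

nonPos*nonNeg⇒nonPos : ∀ {a b} → a ≤ 0ℤ → 0ℤ ≤ b → a * b ≤ 0ℤ
nonPos*nonNeg⇒nonPos {b = b} a≤0 0≤b = *-monoʳ-≤-nonNeg b {{nonNegative 0≤b}} a≤0

nonNeg*≡1⇒≡1 : ∀ {a b} → 0ℤ ≤ a → a * b ≡ 1ℤ → a ≡ 1ℤ
nonNeg*≡1⇒≡1 {a} {b} 0≤a ab≡1 =
  trans (sym (0≤i⇒+∣i∣≡i 0≤a)) (cong +_ (ℕ.m*n≡1⇒m≡1 ∣ a ∣ ∣ b ∣ (trans (sym (abs-* a b)) (cong ∣_∣ ab≡1))))

i≤j-k⇒i<j : ∀ {i j k} → i ≤ j - k → 0ℤ < k → i < j
i≤j-k⇒i<j {i} {j} {k} i≤j-k 0<k = ≤-<-trans i≤j-k (subst (j - k <_) (+-identityʳ j) (+-monoʳ-< j (neg-mono-< 0<k)))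

+n≡2i-1⇒0<i : ∀ {n i} → + n ≡ + 2 * i - 1ℤ → 0ℤ < i
+n≡2i-1⇒0<i {n} {i} n≡2i-1 =
  nonNeg*pos⇒pos {+ 2} (+≤+ ℕ.z≤n) (subst (0ℤ <_) (trans (cong (_+_ 1ℤ) n≡2i-1) (cancel i)) (+<+ (ℕ.s≤s ℕ.z≤n)))
  where
  cancel : ∀ i → 1ℤ + (+ 2 * i - 1ℤ) ≡ + 2 * i
  cancel = solve-∀

i≢0⇒0<i*i : ∀ {i} → i ≢ 0ℤ → 0ℤ < i * i
i≢0⇒0<i*i {+0} i≢0 = ⊥-elim (i≢0 refl)
i≢0⇒0<i*i {+[1+ n ]} _ = +<+ (ℕ.s≤s ℕ.z≤n)
i≢0⇒0<i*i { -[1+ n ]} _ = +<+ (ℕ.s≤s ℕ.z≤n)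

∑-cong : ∀ {n} {f g : Fin n → ℤ} → (∀ i → f i ≡ g i) → ∑ f ≡ ∑ g
∑-cong {ℕ.zero} f≗g = refl
∑-cong {ℕ.suc n} f≗g = cong₂ _+_ (f≗g zero) (∑-cong (f≗g ∘ suc))

∑-distrib-+ : ∀ {n} (f g : Fin n → ℤ) → ∑ (λ i → f i + g i) ≡ ∑ f + ∑ g
∑-distrib-+ {ℕ.zero} f g = refl
∑-distrib-+ {ℕ.suc n} f g =
  trans (cong (_+_ (f zero + g zero)) (∑-distrib-+ (f ∘ suc) (g ∘ suc))) (interchange (f zero) (g zero) (∑ (f ∘ suc)) (∑ (g ∘ suc)))
  where
  interchange : ∀ a b c d → (a + b) + (c + d) ≡ (a + c) + (b + d)
  interchange = solve-∀

*-distribˡ-∑ : ∀ {n} c (f : Fin n → ℤ) → c * ∑ f ≡ ∑ (λ i → c * f i)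
*-distribˡ-∑ {ℕ.zero} c f = *-zeroʳ c
*-distribˡ-∑ {ℕ.suc n} c f =
  trans (*-distribˡ-+ c (f zero) _) (cong (_+_ (c * f zero)) (*-distribˡ-∑ c (f ∘ suc)))

∑-zero : ∀ {n} {f : Fin n → ℤ} → (∀ i → f i ≡ 0ℤ) → ∑ f ≡ 0ℤ
∑-zero {ℕ.zero} f≗0 = refl
∑-zero {ℕ.suc n} f≗0 = cong₂ _+_ (f≗0 zero) (∑-zero (f≗0 ∘ suc))

∑-comm : ∀ {m n} (f : Fin m → Fin n → ℤ) →
         ∑ (λ i → ∑ (λ j → f i j)) ≡ ∑ (λ j → ∑ (λ i → f i j))
∑-comm {ℕ.zero} {n} f = sym (∑-zero {n} (λ _ → refl))
∑-comm {ℕ.suc m} f =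
  trans (cong (_+_ (∑ (f zero))) (∑-comm (f ∘ suc))) (sym (∑-distrib-+ (f zero) (λ j → ∑ (λ i → f (suc i) j))))

∑-nonNeg : ∀ {n} {f : Fin n → ℤ} → (∀ i → 0ℤ ≤ f i) → 0ℤ ≤ ∑ f
∑-nonNeg {ℕ.zero} f≥0 = ≤-refl
∑-nonNeg {ℕ.suc n} f≥0 = +-mono-≤ (f≥0 zero) (∑-nonNeg (f≥0 ∘ suc))

∑-pos⇒∃-pos : ∀ {n} (f : Fin n → ℤ) → 0ℤ < ∑ f → ∃[ i ] 0ℤ < f i
∑-pos⇒∃-pos {ℕ.zero} f (+<+ ())
∑-pos⇒∃-pos {ℕ.suc n} f ∑f>0 with 0ℤ <? f zero
... | yes f₀>0 = zero , f₀>0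
... | no f₀≯0 with ∑-pos⇒∃-pos (f ∘ suc) (≰⇒> λ rest≤0 → <⇒≱ ∑f>0 (+-mono-≤ (≮⇒≥ f₀≯0) rest≤0))
...   | i , fᵢ>0 = suc i , fᵢ>0

∑-supported : ∀ {n} (f : Fin n → ℤ) k → (∀ j → j ≢ k → f j ≡ 0ℤ) → ∑ f ≡ f k
∑-supported {ℕ.suc n} f zero f≗0 =
  trans (cong (_+_ (f zero)) (∑-zero (λ j → f≗0 (suc j) λ ()))) (+-identityʳ _)
∑-supported {ℕ.suc n} f (suc k) f≗0 =
  trans (cong (_+ ∑ (f ∘ suc)) (f≗0 zero λ ()))
        (trans (+-identityˡ _) (∑-supported (f ∘ suc) k λ j j≢k → f≗0 (suc j) (j≢k ∘ suc-injective)))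

∑-linear : ∀ {n} (f g : Fin n → ℤ) c → ∑ (λ i → f i + c * g i) ≡ ∑ f + c * ∑ g
∑-linear f g c = trans (∑-distrib-+ f (λ i → c * g i)) (cong (_+_ (∑ f)) (sym (*-distribˡ-∑ c g)))

e-diag : ∀ {l} (k : Fin l) → e k k ≡ 1ℤ
e-diag k with k ≟ k
... | yes _ = refl
... | no k≢k = ⊥-elim (k≢k refl)

e-offdiag : ∀ {l} {j k : Fin l} → j ≢ k → e k j ≡ 0ℤ
e-offdiag {j = j} {k} j≢k with j ≟ k
... | yes j≡k = ⊥-elim (j≢k j≡k)
... | no _ = refl

e-nonNeg : ∀ {l} (k j : Fin l) → 0ℤ ≤ e k j
e-nonNeg k j with j ≟ k
... | yes _ = +≤+ ℕ.z≤n
... | no _ = +≤+ ℕ.z≤n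

e-reindex : ∀ {l} (f : Fin l → ℤ) k j → e k j * f k ≡ e k j * f j
e-reindex f k j with j ≟ k
... | yes refl = refl
... | no _ = refl

∑-e* : ∀ {l} k (f : Fin l → ℤ) → ∑ (λ j → e k j * f j) ≡ f k
∑-e* k f = trans (∑-supported _ k λ j j≢k → trans (cong (_* f j) (e-offdiag j≢k)) (*-zeroˡ (f j)))
                 (trans (cong (_* f k) (e-diag k)) (*-identityˡ (f k)))

∑-e : ∀ {l} (k : Fin l) → ∑ (e k) ≡ 1ℤ
∑-e k = trans (∑-supported (e k) k λ j → e-offdiag) (e-diag k)

Nonneg Nonpos : ∀ {l} → Lat l → Set
Nonneg v = ∀ i → 0ℤ ≤ v i
Nonpos v = ∀ i → v i ≤ 0ℤ

infixl 6 _+ᴸ_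
infixr 7 _·ᴸ_

_+ᴸ_ : ∀ {l} → Lat l → Lat l → Lat l
(x +ᴸ y) i = x i + y i

_·ᴸ_ : ∀ {l} → ℤ → Lat l → Lat l
(c ·ᴸ x) i = c * x i

at∧apart⇒∀ : ∀ {l} {P : ℤ → Set} {v : Lat l} i → P (v i) → (∀ k → k ≢ i → P (v k)) → ∀ k → P (v k)
at∧apart⇒∀ i at apart k with k ≟ i
... | yes refl = at
... | no k≢i = apart k k≢i

≗e : ∀ {l} {f : Lat l} {i} → f i ≡ 1ℤ → (∀ k → k ≢ i → f k ≡ 0ℤ) → f ≗ᴸ e i
≗e {i = i} fᵢ≡1 apart≡0 k with k ≟ i
... | yes refl = fᵢ≡1
... | no k≢i = apart≡0 k k≢i

erase : ∀ {l} → Fin l → Lat l → Lat l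
erase j v = v +ᴸ (- v j) ·ᴸ e j

erase-apart : ∀ {l} {j b : Fin l} (v : Lat l) → b ≢ j → erase j v b ≡ v b
erase-apart {j = j} {b} v b≢j = trans (cong (λ t → v b + (- v j) * t) (e-offdiag b≢j)) (vanish (v b) (v j))
  where
  vanish : ∀ a p → a + (- p) * 0ℤ ≡ a
  vanish = solve-∀

erase-at : ∀ {l} (j : Fin l) v → erase j v j ≡ 0ℤ
erase-at j v = trans (cong (λ t → v j + (- v j) * t) (e-diag j)) (cancel (v j))
  where
  cancel : ∀ a → a + (- a) * 1ℤ ≡ 0ℤ
  cancel = solve-∀

erase-restore : ∀ {l} (j : Fin l) v → v ≗ᴸ (erase j v +ᴸ v j ·ᴸ e j)
erase-restore j v b = sym (cancel (v b) (v j) (e j b))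
  where
  cancel : ∀ a p q → a + (- p) * q + p * q ≡ a
  cancel = solve-∀

module _ {l : ℕ} (C : CartanDatum l) where
  open CartanDatum C

  infix 9 _⦅_⦆

  ⟨_,_⟩ : Lat l → Lat l → ℤ
  ⟨_,_⟩ = ⟪_,_⟫ C

  _⦅_⦆ : Lat l → Lat l → ℤ
  x ⦅ h ⦆ = pair C x h

  ⟨⟩-cong : ∀ {x x′ y y′} → x ≗ᴸ x′ → y ≗ᴸ y′ → ⟨ x , y ⟩ ≡ ⟨ x′ , y′ ⟩
  ⟨⟩-cong x≗x′ y≗y′ = ∑-cong λ i → ∑-cong λ j → cong₂ (λ a b → a * d i * A i j * b) (x≗x′ i) (y≗y′ j)

  ⟨⟩-sym : ∀ x y → ⟨ x , y ⟩ ≡ ⟨ y , x ⟩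
  ⟨⟩-sym x y = trans (∑-comm (λ i j → x i * d i * A i j * y j)) (∑-cong λ j → ∑-cong λ i → swap j i)
    where
    regroup : ∀ a p q b → a * p * q * b ≡ (p * q) * (a * b)
    regroup = solve-∀
    ungroup : ∀ a p q b → (p * q) * (a * b) ≡ b * p * q * a
    ungroup = solve-∀
    swap : ∀ j i → x i * d i * A i j * y j ≡ y j * d j * A j i * x i
    swap j i = trans (regroup (x i) (d i) (A i j) (y j))
                     (trans (cong (_* (x i * y j)) (symm i j)) (ungroup (x i) (d j) (A j i) (y j)))

  ⟨⟩-linearʳ : ∀ x y c z → ⟨ x , y +ᴸ c ·ᴸ z ⟩ ≡ ⟨ x , y ⟩ + c * ⟨ x , z ⟩
  ⟨⟩-linearʳ x y c z = trans (∑-cong λ i → trans (∑-cong λ j → distrib (x i * d i * A i j) (y j) c (z j))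
                                                (∑-linear {l} _ _ c))
                             (∑-linear {l} _ _ c)
    where
    distrib : ∀ p a c b → p * (a + c * b) ≡ p * a + c * (p * b)
    distrib = solve-∀

  ⟨⟩-linearˡ : ∀ x c z y → ⟨ x +ᴸ c ·ᴸ z , y ⟩ ≡ ⟨ x , y ⟩ + c * ⟨ z , y ⟩
  ⟨⟩-linearˡ x c z y = trans (⟨⟩-sym _ y) (trans (⟨⟩-linearʳ y x c z)
                                                 (cong₂ (λ a b → a + c * b) (⟨⟩-sym y x) (⟨⟩-sym y z)))

  ⟨⟩-expand : ∀ x a y b z →
              ⟨ x +ᴸ a ·ᴸ z , y +ᴸ b ·ᴸ z ⟩ ≡ ⟨ x , y ⟩ + b * ⟨ x , z ⟩ + a * (⟨ z , y ⟩ + b * ⟨ z , z ⟩)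
  ⟨⟩-expand x a y b z = trans (⟨⟩-linearˡ x a z _)
                              (cong₂ (λ p q → p + a * q) (⟨⟩-linearʳ x y b z) (⟨⟩-linearʳ z y b z))

  ⦅⦆-cong : ∀ {x x′ h h′} → x ≗ᴸ x′ → h ≗ᴸ h′ → x ⦅ h ⦆ ≡ x′ ⦅ h′ ⦆
  ⦅⦆-cong x≗x′ h≗h′ = ∑-cong λ i → cong₂ _*_ (h≗h′ i) (∑-cong λ j → cong (_* A i j) (x≗x′ j))

  ⦅⦆-congˡ : ∀ {x x′} → x ≗ᴸ x′ → ∀ h → x ⦅ h ⦆ ≡ x′ ⦅ h ⦆
  ⦅⦆-congˡ x≗x′ h = ⦅⦆-cong {h = h} {h′ = h} x≗x′ λ _ → refl

  ⦅⦆-linearˡ : ∀ x c y h → (x +ᴸ c ·ᴸ y) ⦅ h ⦆ ≡ x ⦅ h ⦆ + c * y ⦅ h ⦆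
  ⦅⦆-linearˡ x c y h =
    trans (∑-cong λ i → trans (cong (h i *_) (trans (∑-cong λ j → distribʳ (x j) c (y j) (A i j))
                                                      (∑-linear (xA i) (yA i) c)))
                              (distribˡ (h i) c (∑ (xA i)) (∑ (yA i))))
          (∑-linear (λ i → h i * ∑ (xA i)) (λ i → h i * ∑ (yA i)) c)
    where
    xA yA : Fin l → Fin l → ℤ
    xA i j = x j * A i j
    yA i j = y j * A i j
    distribʳ : ∀ a c b p → (a + c * b) * p ≡ a * p + c * (b * p)
    distribʳ = solve-∀
    distribˡ : ∀ h c a b → h * (a + c * b) ≡ h * a + c * (h * b)
    distribˡ = solve-∀

  ⦅e⦆ : ∀ x k → x ⦅ e k ⦆ ≡ ∑ (λ j → x j * A k j)
  ⦅e⦆ x k = ∑-e* k (λ i → ∑ (λ j → x j * A i j))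

  e⦅e⦆ : ∀ k → e k ⦅ e k ⦆ ≡ + 2
  e⦅e⦆ k = trans (⦅e⦆ (e k) k) (trans (∑-e* k (A k)) (diag k))

  pairing-via-coroot : ∀ {h y N} → (∀ i → h i * N ≡ + 2 * y i * d i) → ∀ x → x ⦅ h ⦆ * N ≡ + 2 * ⟨ y , x ⟩
  pairing-via-coroot {h} {y} {N} h≈y x = begin
    x ⦅ h ⦆ * N                                         ≡⟨ *-comm (x ⦅ h ⦆) N ⟩
    N * ∑ (λ i → h i * ∑ (xA i))                         ≡⟨ *-distribˡ-∑ {l} N _ ⟩
    ∑ (λ i → N * (h i * ∑ (xA i)))                       ≡⟨ ∑-cong term ⟩
    ∑ (λ i → + 2 * ∑ (λ j → y i * d i * A i j * x j))    ≡⟨ *-distribˡ-∑ {l} (+ 2) _ ⟨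
    + 2 * ⟨ y , x ⟩                                      ∎
    where
    xA : Fin l → Fin l → ℤ
    xA i j = x j * A i j
    regroup : ∀ N h s → N * (h * s) ≡ h * N * s
    regroup = solve-∀
    factor : ∀ y d s → + 2 * y * d * s ≡ + 2 * (y * d * s)
    factor = solve-∀
    reorder : ∀ y d a x → y * d * (x * a) ≡ y * d * a * x
    reorder = solve-∀
    term : ∀ i → N * (h i * ∑ (xA i)) ≡ + 2 * ∑ (λ j → y i * d i * A i j * x j)
    term i = begin
      N * (h i * ∑ (xA i))                    ≡⟨ regroup N (h i) _ ⟩
      h i * N * ∑ (xA i)                      ≡⟨ cong (_* ∑ (xA i)) (h≈y i) ⟩
      + 2 * y i * d i * ∑ (xA i)              ≡⟨ factor (y i) (d i) _ ⟩
      + 2 * (y i * d i * ∑ (xA i))            ≡⟨ cong (+ 2 *_) (*-distribˡ-∑ (y i * d i) (xA i)) ⟩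
      + 2 * ∑ (λ j → y i * d i * xA i j)      ≡⟨ cong (+ 2 *_) (∑-cong λ j → reorder (y i) (d i) (A i j) (x j)) ⟩
      + 2 * ∑ (λ j → y i * d i * A i j * x j) ∎

  e-scaled : ∀ k i → e k i * (+ 2 * d k) ≡ + 2 * e k i * d i
  e-scaled k i = begin
    e k i * (+ 2 * d k)   ≡⟨ factor (e k i) (d k) ⟩
    + 2 * (e k i * d k)   ≡⟨ cong (+ 2 *_) (e-reindex d k i) ⟩
    + 2 * (e k i * d i)   ≡⟨ *-assoc (+ 2) (e k i) (d i) ⟨
    + 2 * e k i * d i     ∎
    where
    factor : ∀ a b → a * (+ 2 * b) ≡ + 2 * (a * b)
    factor = solve-∀

  ⦅e⦆*d : ∀ x k → x ⦅ e k ⦆ * d k ≡ ⟨ e k , x ⟩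
  ⦅e⦆*d x k = *-cancelˡ-≡ (+ 2) _ _ (trans (factor (x ⦅ e k ⦆) (d k)) (pairing-via-coroot {e k} {e k} (e-scaled k) x))
    where
    factor : ∀ a b → + 2 * (a * b) ≡ a * (+ 2 * b)
    factor = solve-∀

  ⟨e,e⟩ : ∀ k → ⟨ e k , e k ⟩ ≡ + 2 * d k
  ⟨e,e⟩ k = trans (sym (⦅e⦆*d (e k) k)) (cong (_* d k) (e⦅e⦆ k))

  ⟨e,e⟩-pos : ∀ k → 0ℤ < ⟨ e k , e k ⟩
  ⟨e,e⟩-pos k = subst (0ℤ <_) (sym (⟨e,e⟩ k)) (*-monoˡ-<-pos (+ 2) (d-pos k))

  e-coroot : ∀ k → IsCorootOf C (e k) (e k)
  e-coroot k i = trans (cong (e k i *_) (⟨e,e⟩ k)) (e-scaled k i)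

  ⟨⟩-by-coordinates : ∀ x y → ⟨ x , y ⟩ ≡ ∑ (λ i → x i * ⟨ e i , y ⟩)
  ⟨⟩-by-coordinates x y = ∑-cong λ i → begin
    ∑ (λ j → x i * d i * A i j * y j)       ≡⟨ ∑-cong (λ j → reorder (x i) (d i) (A i j) (y j)) ⟩
    ∑ (λ j → x i * d i * (y j * A i j))     ≡⟨ *-distribˡ-∑ {l} (x i * d i) _ ⟨
    x i * d i * ∑ (λ j → y j * A i j)       ≡⟨ cong (x i * d i *_) (⦅e⦆ y i) ⟨
    x i * d i * y ⦅ e i ⦆                   ≡⟨ regroup (x i) (d i) (y ⦅ e i ⦆) ⟩
    x i * (y ⦅ e i ⦆ * d i)                 ≡⟨ cong (x i *_) (⦅e⦆*d y i) ⟩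
    x i * ⟨ e i , y ⟩                        ∎
    where
    reorder : ∀ x d a y → x * d * a * y ≡ x * d * (y * a)
    reorder = solve-∀
    regroup : ∀ x d p → x * d * p ≡ x * (p * d)
    regroup = solve-∀

  coroot-pairing : ∀ {γ m} → IsCorootOf C γ m → ∀ x → x ⦅ m ⦆ * ⟨ γ , γ ⟩ ≡ + 2 * ⟨ γ , x ⟩
  coroot-pairing {γ} {m} γ^∨ = pairing-via-coroot {m} {γ} {⟨ γ , γ ⟩} γ^∨

  coroot-self : ∀ {γ m} → IsCorootOf C γ m → 0ℤ < ⟨ γ , γ ⟩ → γ ⦅ m ⦆ ≡ + 2
  coroot-self {γ} {m} γ^∨ N>0 =
    *-cancelʳ-≡ _ _ ⟨ γ , γ ⟩ {{>-nonZero N>0}} (coroot-pairing {γ} {m} γ^∨ γ)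

  pairing-sym : ∀ {α mα β mβ} → IsCorootOf C α mα → IsCorootOf C β mβ →
                β ⦅ mα ⦆ * ⟨ α , α ⟩ ≡ α ⦅ mβ ⦆ * ⟨ β , β ⟩
  pairing-sym {α} {mα} {β} {mβ} α^∨ β^∨ =
    trans (coroot-pairing {α} {mα} α^∨ β) (trans (cong (+ 2 *_) (⟨⟩-sym α β)) (sym (coroot-pairing {β} {mβ} β^∨ α)))

  pairing-zero-sym : ∀ {α mα β mβ} → IsCorootOf C α mα → IsCorootOf C β mβ → 0ℤ < ⟨ α , α ⟩ →
                     α ⦅ mβ ⦆ ≡ 0ℤ → β ⦅ mα ⦆ ≡ 0ℤ
  pairing-zero-sym {α} {mα} {β} {mβ} α^∨ β^∨ Nα>0 p≡0 =
    *-cancelʳ-≡ _ 0ℤ ⟨ α , α ⟩ {{>-nonZero Nα>0}}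
      (trans (pairing-sym {α} {mα} {β} {mβ} α^∨ β^∨) (cong (_* ⟨ β , β ⟩) p≡0))

  IsCorootOf-cong : ∀ {γ γ′ m m′} → γ ≗ᴸ γ′ → m ≗ᴸ m′ → IsCorootOf C γ m → IsCorootOf C γ′ m′
  IsCorootOf-cong γ≗γ′ m≗m′ γ^∨ i =
    trans (cong₂ _*_ (sym (m≗m′ i)) (⟨⟩-cong (sym ∘ γ≗γ′) (sym ∘ γ≗γ′)))
          (trans (γ^∨ i) (cong (λ t → + 2 * t * d i) (γ≗γ′ i)))

  reflect : Lat l → Lat l → Lat l → Lat l
  reflect = D.refl C

  reflect-as-sum : ∀ γ m x → reflect γ m x ≗ᴸ (x +ᴸ (- x ⦅ m ⦆) ·ᴸ γ)
  reflect-as-sum γ m x j = cong (_+_ (x j)) (neg-distribˡ-* (x ⦅ m ⦆) (γ j))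

  reflect-cong : ∀ {γ γ′ m m′ x x′} → γ ≗ᴸ γ′ → m ≗ᴸ m′ → x ≗ᴸ x′ → reflect γ m x ≗ᴸ reflect γ′ m′ x′
  reflect-cong γ≗γ′ m≗m′ x≗x′ j = cong₂ _-_ (x≗x′ j) (cong₂ _*_ (⦅⦆-cong x≗x′ m≗m′) (γ≗γ′ j))

  reflect-pairing : ∀ γ m x h → reflect γ m x ⦅ h ⦆ ≡ x ⦅ h ⦆ + (- x ⦅ m ⦆) * γ ⦅ h ⦆
  reflect-pairing γ m x h = trans (⦅⦆-congˡ (reflect-as-sum γ m x) h) (⦅⦆-linearˡ x (- x ⦅ m ⦆) γ h)

  reflect-linear : ∀ γ m x c y → reflect γ m (x +ᴸ c ·ᴸ y) ≗ᴸ (reflect γ m x +ᴸ c ·ᴸ reflect γ m y)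
  reflect-linear γ m x c y j = begin
    x j + c * y j - (x +ᴸ c ·ᴸ y) ⦅ m ⦆ * γ j       ≡⟨ cong (λ t → x j + c * y j - t * γ j) (⦅⦆-linearˡ x c y m) ⟩
    x j + c * y j - (x ⦅ m ⦆ + c * y ⦅ m ⦆) * γ j   ≡⟨ distrib (x j) c (y j) (x ⦅ m ⦆) (y ⦅ m ⦆) (γ j) ⟩
    x j - x ⦅ m ⦆ * γ j + c * (y j - y ⦅ m ⦆ * γ j) ∎
    where
    distrib : ∀ a c b p q g → a + c * b - (p + c * q) * g ≡ a - p * g + c * (b - q * g)
    distrib = solve-∀

  module _ {γ m} (γ^∨ : IsCorootOf C γ m) (N>0 : 0ℤ < ⟨ γ , γ ⟩) where

    reflect-involutive : ∀ x → reflect γ m (reflect γ m x) ≗ᴸ x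
    reflect-involutive x j = begin
      reflect γ m x j - reflect γ m x ⦅ m ⦆ * γ j         ≡⟨ cong (λ t → reflect γ m x j - t * γ j) pairing ⟩
      x j - x ⦅ m ⦆ * γ j - (- x ⦅ m ⦆) * γ j             ≡⟨ cancel (x j) (x ⦅ m ⦆) (γ j) ⟩
      x j                                                 ∎
      where
      negate : ∀ p → p + (- p) * + 2 ≡ - p
      negate = solve-∀
      cancel : ∀ a p g → a - p * g - (- p) * g ≡ a
      cancel = solve-∀
      pairing : reflect γ m x ⦅ m ⦆ ≡ - x ⦅ m ⦆
      pairing = trans (reflect-pairing γ m x m)
                      (trans (cong (λ t → x ⦅ m ⦆ + (- x ⦅ m ⦆) * t) (coroot-self {γ} {m} γ^∨ N>0)) (negate (x ⦅ m ⦆)))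

    reflect-isometry : ∀ x y → ⟨ reflect γ m x , reflect γ m y ⟩ ≡ ⟨ x , y ⟩
    reflect-isometry x y = begin
      ⟨ reflect γ m x , reflect γ m y ⟩                          ≡⟨ ⟨⟩-cong (reflect-as-sum γ m x) (reflect-as-sum γ m y) ⟩
      ⟨ x +ᴸ (- X) ·ᴸ γ , y +ᴸ (- Y) ·ᴸ γ ⟩                      ≡⟨ ⟨⟩-expand x (- X) y (- Y) γ ⟩
      ⟨ x , y ⟩ + (- Y) * ⟨ x , γ ⟩ + (- X) * (⟨ γ , y ⟩ + (- Y) * N) ≡⟨ +-assoc ⟨ x , y ⟩ _ _ ⟩
      ⟨ x , y ⟩ + correction                                     ≡⟨ cong (_+_ ⟨ x , y ⟩) correction≡0 ⟩
      ⟨ x , y ⟩ + 0ℤ                                             ≡⟨ +-identityʳ _ ⟩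
      ⟨ x , y ⟩                                                  ∎
      where
      N X Y correction : ℤ
      N = ⟨ γ , γ ⟩
      X = x ⦅ m ⦆
      Y = y ⦅ m ⦆
      correction = (- Y) * ⟨ x , γ ⟩ + (- X) * (⟨ γ , y ⟩ + (- Y) * N)
      F : ℤ → ℤ → ℤ
      F p q = (- q) * ⟨ x , γ ⟩ + (- p) * ⟨ γ , y ⟩ + p * q
      expand : ∀ X Y a b N → ((- Y) * a + (- X) * (b + (- Y) * N)) * N ≡ (- (Y * N)) * a + (- (X * N)) * b + (X * N) * (Y * N)
      expand = solve-∀
      vanish : ∀ a b → (- (+ 2 * b)) * a + (- (+ 2 * a)) * b + (+ 2 * a) * (+ 2 * b) ≡ 0ℤ
      vanish = solve-∀
      correction≡0 : correction ≡ 0ℤ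
      correction≡0 = *-cancelʳ-≡ correction 0ℤ N {{>-nonZero N>0}} (begin
        correction * N                         ≡⟨ expand X Y ⟨ x , γ ⟩ ⟨ γ , y ⟩ N ⟩
        F (X * N) (Y * N)                      ≡⟨ cong₂ F (trans (coroot-pairing {γ} {m} γ^∨ x) (cong (+ 2 *_) (⟨⟩-sym γ x)))
                                                           (coroot-pairing {γ} {m} γ^∨ y) ⟩
        F (+ 2 * ⟨ x , γ ⟩) (+ 2 * ⟨ γ , y ⟩)  ≡⟨ vanish ⟨ x , γ ⟩ ⟨ γ , y ⟩ ⟩
        0ℤ                                     ∎)

    reflect-coroot : ∀ {x n} → IsCorootOf C x n → IsCorootOf C (reflect γ m x) (n +ᴸ (- γ ⦅ n ⦆) ·ᴸ m)
    reflect-coroot {x} {n} x^∨ i = begin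
      (n i + (- G) * m i) * ⟨ reflect γ m x , reflect γ m x ⟩ ≡⟨ cong ((n i + (- G) * m i) *_) (reflect-isometry x x) ⟩
      (n i + (- G) * m i) * Nx                               ≡⟨ distrib (n i) G (m i) Nx ⟩
      n i * Nx - G * Nx * m i                                ≡⟨ cong₂ _-_ (x^∨ i) key ⟩
      + 2 * x i * d i - X * (+ 2 * γ i * d i)                ≡⟨ factor (x i) X (γ i) (d i) ⟩
      + 2 * (x i - X * γ i) * d i                            ∎
      where
      G X Nx : ℤ
      G = γ ⦅ n ⦆
      X = x ⦅ m ⦆
      Nx = ⟨ x , x ⟩
      distrib : ∀ n G m N → (n + (- G) * m) * N ≡ n * N - G * N * m
      distrib = solve-∀
      factor : ∀ x X g d → + 2 * x * d - X * (+ 2 * g * d) ≡ + 2 * (x - X * g) * d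
      factor = solve-∀
      regroup : ∀ a b c → a * b * c ≡ a * (b * c)
      regroup = solve-∀
      swap : ∀ a b c → a * b * c ≡ a * c * b
      swap = solve-∀
      key : G * Nx * m i ≡ X * (+ 2 * γ i * d i)
      key = *-cancelʳ-≡ _ _ ⟨ γ , γ ⟩ {{>-nonZero N>0}} (begin
        G * Nx * m i * ⟨ γ , γ ⟩                  ≡⟨ regroup (G * Nx) (m i) _ ⟩
        G * Nx * (m i * ⟨ γ , γ ⟩)                ≡⟨ cong₂ _*_ (coroot-pairing {x} {n} x^∨ γ) (γ^∨ i) ⟩
        + 2 * ⟨ x , γ ⟩ * (+ 2 * γ i * d i)       ≡⟨ cong (λ t → + 2 * t * (+ 2 * γ i * d i)) (⟨⟩-sym x γ) ⟩
        + 2 * ⟨ γ , x ⟩ * (+ 2 * γ i * d i)       ≡⟨ cong (_* (+ 2 * γ i * d i)) (coroot-pairing {γ} {m} γ^∨ x) ⟨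
        X * ⟨ γ , γ ⟩ * (+ 2 * γ i * d i)         ≡⟨ swap X _ _ ⟩
        X * (+ 2 * γ i * d i) * ⟨ γ , γ ⟩         ∎)

  s : Fin l → Lat l → Lat l
  s = sref C

  ⟦_⟧ : List (Fin l) → Lat l → Lat l
  ⟦_⟧ = act C

  IsWordFor : List (Fin l) → (Lat l → Lat l) → Set
  IsWordFor w f = ∀ x → ⟦ w ⟧ x ≗ᴸ f x

  HasLength-unique : ∀ {f a b} → HasLength C f a → HasLength C f b → a ≡ b
  HasLength-unique ((wa , |wa|≡a , wa-spells) , a-minimal) ((wb , |wb|≡b , wb-spells) , b-minimal) =
    ℕ.≤-antisym (subst (_ ℕ.≤_) |wb|≡b (a-minimal wb wb-spells)) (subst (_ ℕ.≤_) |wa|≡a (b-minimal wa wa-spells))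

  s-apart : ∀ i x {k} → k ≢ i → s i x k ≡ x k
  s-apart i x {k} k≢i = trans (cong (λ t → x k - x ⦅ e i ⦆ * t) (e-offdiag k≢i)) (vanish (x k) (x ⦅ e i ⦆))
    where
    vanish : ∀ a p → a - p * 0ℤ ≡ a
    vanish = solve-∀

  s-cong : ∀ i {x x′} → x ≗ᴸ x′ → s i x ≗ᴸ s i x′
  s-cong i = reflect-cong {e i} {e i} {e i} {e i} (λ _ → refl) (λ _ → refl)

  s-involutive : ∀ i x → s i (s i x) ≗ᴸ x
  s-involutive i = reflect-involutive {e i} {e i} (e-coroot i) (⟨e,e⟩-pos i)

  s-isometry : ∀ i x y → ⟨ s i x , s i y ⟩ ≡ ⟨ x , y ⟩
  s-isometry i = reflect-isometry {e i} {e i} (e-coroot i) (⟨e,e⟩-pos i)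

  s-coroot : ∀ i {v n} → IsCorootOf C v n → IsCorootOf C (s i v) (n +ᴸ (- e i ⦅ n ⦆) ·ᴸ e i)
  s-coroot i {v} {n} = reflect-coroot {e i} {e i} (e-coroot i) (⟨e,e⟩-pos i) {v} {n}

  ⟦⟧-cong : ∀ w {x x′} → x ≗ᴸ x′ → ⟦ w ⟧ x ≗ᴸ ⟦ w ⟧ x′
  ⟦⟧-cong [] x≗x′ = x≗x′
  ⟦⟧-cong (i ∷ w) x≗x′ = s-cong i (⟦⟧-cong w x≗x′)

  ⟦⟧-++ : ∀ u v x → ⟦ u ++ v ⟧ x ≡ ⟦ u ⟧ (⟦ v ⟧ x)
  ⟦⟧-++ [] v x = refl
  ⟦⟧-++ (i ∷ u) v x = cong (s i) (⟦⟧-++ u v x)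

  ⟦⟧-linear : ∀ w x c y → ⟦ w ⟧ (x +ᴸ c ·ᴸ y) ≗ᴸ (⟦ w ⟧ x +ᴸ c ·ᴸ ⟦ w ⟧ y)
  ⟦⟧-linear [] x c y j = refl
  ⟦⟧-linear (i ∷ w) x c y j =
    trans (s-cong i (⟦⟧-linear w x c y) j) (reflect-linear (e i) (e i) (⟦ w ⟧ x) c (⟦ w ⟧ y) j)

  ⟦⟧-isometry : ∀ w x y → ⟨ ⟦ w ⟧ x , ⟦ w ⟧ y ⟩ ≡ ⟨ x , y ⟩
  ⟦⟧-isometry [] x y = refl
  ⟦⟧-isometry (i ∷ w) x y = trans (s-isometry i (⟦ w ⟧ x) (⟦ w ⟧ y)) (⟦⟧-isometry w x y)

  ⟦⟧-reverse : ∀ w x → ⟦ reverse w ⟧ (⟦ w ⟧ x) ≗ᴸ x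
  ⟦⟧-reverse [] x j = refl
  ⟦⟧-reverse (i ∷ w) x j = begin
    ⟦ reverse (i ∷ w) ⟧ (s i (⟦ w ⟧ x)) j     ≡⟨ cong (λ u → ⟦ u ⟧ (s i (⟦ w ⟧ x)) j) (unfold-reverse i w) ⟩
    ⟦ reverse w ++ [ i ] ⟧ (s i (⟦ w ⟧ x)) j  ≡⟨ cong (λ t → t j) (⟦⟧-++ (reverse w) [ i ] (s i (⟦ w ⟧ x))) ⟩
    ⟦ reverse w ⟧ (s i (s i (⟦ w ⟧ x))) j      ≡⟨ ⟦⟧-cong (reverse w) (s-involutive i (⟦ w ⟧ x)) j ⟩
    ⟦ reverse w ⟧ (⟦ w ⟧ x) j                  ≡⟨ ⟦⟧-reverse w x j ⟩
    x j                                        ∎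

  ⟦⟧-reflect : ∀ w {γ m γ′ m′} → IsCorootOf C γ m → IsCorootOf C γ′ m′ → 0ℤ < ⟨ γ , γ ⟩ →
               γ′ ≗ᴸ ⟦ w ⟧ γ → ∀ x → ⟦ w ⟧ (reflect γ m x) ≗ᴸ reflect γ′ m′ (⟦ w ⟧ x)
  ⟦⟧-reflect w {γ} {m} {γ′} {m′} γ^∨ γ′^∨ N>0 γ′≗wγ x j = begin
    ⟦ w ⟧ (reflect γ m x) j            ≡⟨ ⟦⟧-cong w (reflect-as-sum γ m x) j ⟩
    ⟦ w ⟧ (x +ᴸ (- X) ·ᴸ γ) j          ≡⟨ ⟦⟧-linear w x (- X) γ j ⟩
    ⟦ w ⟧ x j + (- X) * ⟦ w ⟧ γ j      ≡⟨ cong₂ (λ p g → ⟦ w ⟧ x j + (- p) * g) (sym same-pairing) (sym (γ′≗wγ j)) ⟩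
    ⟦ w ⟧ x j + (- X′) * γ′ j          ≡⟨ reflect-as-sum γ′ m′ (⟦ w ⟧ x) j ⟨
    reflect γ′ m′ (⟦ w ⟧ x) j          ∎
    where
    X X′ : ℤ
    X = x ⦅ m ⦆
    X′ = ⟦ w ⟧ x ⦅ m′ ⦆
    same-pairing : X′ ≡ X
    same-pairing = *-cancelʳ-≡ X′ X ⟨ γ , γ ⟩ {{>-nonZero N>0}} (begin
      X′ * ⟨ γ , γ ⟩               ≡⟨ cong (X′ *_) (trans (⟨⟩-cong γ′≗wγ γ′≗wγ) (⟦⟧-isometry w γ γ)) ⟨
      X′ * ⟨ γ′ , γ′ ⟩             ≡⟨ coroot-pairing {γ′} {m′} γ′^∨ (⟦ w ⟧ x) ⟩
      + 2 * ⟨ γ′ , ⟦ w ⟧ x ⟩       ≡⟨ cong (+ 2 *_) (trans (⟨⟩-cong {y = ⟦ w ⟧ x} γ′≗wγ (λ _ → refl)) (⟦⟧-isometry w γ x)) ⟩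
      + 2 * ⟨ γ , x ⟩              ≡⟨ coroot-pairing {γ} {m} γ^∨ x ⟨
      X * ⟨ γ , γ ⟩                ∎)

  root-cong : ∀ {v v′} → v ≗ᴸ v′ → IsRoot C v → IsRoot C v′
  root-cong v≗v′ (w , k , v≗) = w , k , λ j → trans (sym (v≗v′ j)) (v≗ j)

  root-⟦⟧ : ∀ w {v} → IsRoot C v → IsRoot C (⟦ w ⟧ v)
  root-⟦⟧ w (u , k , v≗) = w ++ u , k , λ j → trans (⟦⟧-cong w v≗ j) (sym (cong (λ t → t j) (⟦⟧-++ w u (e k))))

  root-norm-pos : ∀ {v} → IsRoot C v → 0ℤ < ⟨ v , v ⟩
  root-norm-pos (w , k , v≗) =
    subst (0ℤ <_) (sym (trans (⟨⟩-cong v≗ v≗) (⟦⟧-isometry w (e k) (e k)))) (⟨e,e⟩-pos k)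

  image-coroot : ∀ k w → ∃[ n ] IsCorootOf C (⟦ w ⟧ (e k)) n
  image-coroot k [] = e k , e-coroot k
  image-coroot k (i ∷ w) =
    let (n , n^∨) = image-coroot k w in n +ᴸ (- e i ⦅ n ⦆) ·ᴸ e i , s-coroot i {⟦ w ⟧ (e k)} {n} n^∨

  root-coroot : ∀ {v} → IsRoot C v → ∃[ n ] IsCorootOf C v n
  root-coroot (w , k , v≗) =
    let (n , n^∨) = image-coroot k w in n , IsCorootOf-cong {m = n} {m′ = n} (sym ∘ v≗) (λ _ → refl) n^∨

  coordinate*coroot : ∀ {v n} j → IsCorootOf C v n → v j * n j * ⟨ v , v ⟩ ≡ v j * v j * ⟨ e j , e j ⟩
  coordinate*coroot {v} {n} j v^∨ = begin
    v j * n j * ⟨ v , v ⟩        ≡⟨ *-assoc (v j) (n j) _ ⟩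
    v j * (n j * ⟨ v , v ⟩)      ≡⟨ cong (v j *_) (v^∨ j) ⟩
    v j * (+ 2 * v j * d j)      ≡⟨ regroup (v j) (d j) ⟩
    v j * v j * (+ 2 * d j)      ≡⟨ cong (v j * v j *_) (⟨e,e⟩ j) ⟨
    v j * v j * ⟨ e j , e j ⟩    ∎
    where
    regroup : ∀ v d → v * (+ 2 * v * d) ≡ v * v * (+ 2 * d)
    regroup = solve-∀

  norm≤coordinate² : ∀ {v n} j → IsCorootOf C v n → 0ℤ < ⟨ v , v ⟩ → v j ≢ 0ℤ →
                     ⟨ v , v ⟩ ≤ v j * v j * ⟨ e j , e j ⟩
  norm≤coordinate² {v} {n} j v^∨ N>0 vⱼ≢0 =
    subst₂ _≤_ (*-identityˡ _) (coordinate*coroot {v} {n} j v^∨)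
           (*-monoʳ-≤-nonNeg ⟨ v , v ⟩ {{nonNegative (<⇒≤ N>0)}} (i<j⇒suc[i]≤j vⱼnⱼ>0))
    where
    vⱼnⱼ>0 : 0ℤ < v j * n j
    vⱼnⱼ>0 = pos*⇒pos N>0 (subst (0ℤ <_) (sym (coordinate*coroot {v} {n} j v^∨))
                                 (pos*pos⇒pos (i≢0⇒0<i*i vⱼ≢0) (⟨e,e⟩-pos j)))

  norm-split : ∀ v j → ⟨ v , v ⟩ ≡ ⟨ erase j v , erase j v ⟩ + + 2 * (v j * ⟨ e j , erase j v ⟩) + v j * v j * ⟨ e j , e j ⟩
  norm-split v j = begin
    ⟨ v , v ⟩                                                         ≡⟨ ⟨⟩-cong (erase-restore j v) (erase-restore j v) ⟩
    ⟨ u +ᴸ v j ·ᴸ e j , u +ᴸ v j ·ᴸ e j ⟩                            ≡⟨ ⟨⟩-expand u (v j) u (v j) (e j) ⟩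
    ⟨ u , u ⟩ + v j * ⟨ u , e j ⟩ + v j * (⟨ e j , u ⟩ + v j * E)    ≡⟨ cong (λ t → ⟨ u , u ⟩ + v j * t + v j * (⟨ e j , u ⟩ + v j * E))
                                                                              (⟨⟩-sym u (e j)) ⟩
    ⟨ u , u ⟩ + v j * ⟨ e j , u ⟩ + v j * (⟨ e j , u ⟩ + v j * E)    ≡⟨ collect ⟨ u , u ⟩ (v j) ⟨ e j , u ⟩ E ⟩
    ⟨ u , u ⟩ + + 2 * (v j * ⟨ e j , u ⟩) + v j * v j * E            ∎
    where
    u : Lat l
    u = erase j v
    E : ℤ
    E = ⟨ e j , e j ⟩
    collect : ∀ P v X Z → P + v * X + v * (X + v * Z) ≡ P + + 2 * (v * X) + v * v * Z
    collect = solve-∀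

  cross-term-nonNeg : ∀ {v} j → (∀ k → k ≢ j → v j * v k ≤ 0ℤ) → 0ℤ ≤ v j * ⟨ e j , erase j v ⟩
  cross-term-nonNeg {v} j opposite = subst (0ℤ ≤_) regroup
    (nonNeg*nonNeg⇒nonNeg (subst (0ℤ ≤_) (sym (*-distribˡ-∑ (v j) (λ b → u b * A j b))) (∑-nonNeg term-nonNeg))
                          (<⇒≤ (d-pos j)))
    where
    u : Lat l
    u = erase j v
    term-nonNeg : ∀ b → 0ℤ ≤ v j * (u b * A j b)
    term-nonNeg b = by-cases (b ≟ j)
      where
      by-cases : Dec (b ≡ j) → 0ℤ ≤ v j * (u b * A j b)
      by-cases (yes b≡j) = ≤-reflexive (sym (trans (cong (λ t → v j * (t * A j b)) (trans (cong u b≡j) (erase-at j v)))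
                                                   (*-zeroʳ (v j))))
      by-cases (no b≢j) = subst (0ℤ ≤_) (trans (cong (λ t → v j * t * A j b) (sym (erase-apart v b≢j)))
                                               (*-assoc (v j) (u b) (A j b)))
                                (nonPos*nonPos⇒nonNeg (opposite b b≢j) (offdiag j b (b≢j ∘ sym)))
    regroup : v j * ∑ (λ b → u b * A j b) * d j ≡ v j * ⟨ e j , u ⟩
    regroup = begin
      v j * ∑ (λ b → u b * A j b) * d j    ≡⟨ *-assoc (v j) _ (d j) ⟩
      v j * (∑ (λ b → u b * A j b) * d j)  ≡⟨ cong (λ t → v j * (t * d j)) (⦅e⦆ u j) ⟨
      v j * (u ⦅ e j ⦆ * d j)              ≡⟨ cong (v j *_) (⦅e⦆*d u j) ⟩
      v j * ⟨ e j , u ⟩                    ∎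

  opposite-signs⇒supported : ∀ {v n} j → IsCorootOf C v n → 0ℤ < ⟨ v , v ⟩ → v j ≢ 0ℤ →
                             (∀ k → k ≢ j → v j * v k ≤ 0ℤ) → ∀ k → k ≢ j → v k ≡ 0ℤ
  opposite-signs⇒supported {v} {n} j v^∨ N>0 vⱼ≢0 opposite k k≢j with v k ≟ℤ 0ℤ
  ... | yes vₖ≡0 = vₖ≡0
  ... | no vₖ≢0 = ⊥-elim (<⇒≱ longer (norm≤coordinate² {v} {n} j v^∨ N>0 vⱼ≢0))
    where
    erased-norm-pos : 0ℤ < ⟨ erase j v , erase j v ⟩
    erased-norm-pos = posdef (erase j v) (k , λ uₖ≡0 → vₖ≢0 (trans (sym (erase-apart v k≢j)) uₖ≡0))
    longer : v j * v j * ⟨ e j , e j ⟩ < ⟨ v , v ⟩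
    longer = subst₂ _<_ (+-identityˡ _) (sym (norm-split v j))
      (+-monoˡ-< (v j * v j * ⟨ e j , e j ⟩)
        (+-mono-<-≤ erased-norm-pos (nonNeg*nonNeg⇒nonNeg {+ 2} (+≤+ ℕ.z≤n) (cross-term-nonNeg {v} j opposite))))

  nonneg-apart⇒sign : ∀ {v} i → IsRoot C v → (∀ k → k ≢ i → 0ℤ ≤ v k) → Nonneg v ⊎ Nonpos v
  nonneg-apart⇒sign {v} i v-root apart≥0 with 0ℤ ≤? v i
  ... | yes vᵢ≥0 = inj₁ (at∧apart⇒∀ {P = 0ℤ ≤_} {v} i vᵢ≥0 apart≥0)
  ... | no vᵢ≱0 = inj₂ (at∧apart⇒∀ {P = _≤ 0ℤ} {v} i (<⇒≤ vᵢ<0) λ k k≢i → ≤-reflexive (apart≡0 k k≢i))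
    where
    vᵢ<0 : v i < 0ℤ
    vᵢ<0 = ≰⇒> vᵢ≱0
    apart≡0 : ∀ k → k ≢ i → v k ≡ 0ℤ
    apart≡0 = let (n , v^∨) = root-coroot v-root in
      opposite-signs⇒supported {v} {n} i v^∨ (root-norm-pos v-root) (<⇒≢ vᵢ<0)
        λ k k≢i → nonPos*nonNeg⇒nonPos (<⇒≤ vᵢ<0) (apart≥0 k k≢i)

  nonpos-apart⇒sign : ∀ {v} i → IsRoot C v → (∀ k → k ≢ i → v k ≤ 0ℤ) → Nonneg v ⊎ Nonpos v
  nonpos-apart⇒sign {v} i v-root apart≤0 with v i ≤? 0ℤ
  ... | yes vᵢ≤0 = inj₂ (at∧apart⇒∀ {P = _≤ 0ℤ} {v} i vᵢ≤0 apart≤0)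
  ... | no vᵢ≰0 = inj₁ (at∧apart⇒∀ {P = 0ℤ ≤_} {v} i (<⇒≤ vᵢ>0) λ k k≢i → ≤-reflexive (sym (apart≡0 k k≢i)))
    where
    vᵢ>0 : 0ℤ < v i
    vᵢ>0 = ≰⇒> vᵢ≰0
    apart≡0 : ∀ k → k ≢ i → v k ≡ 0ℤ
    apart≡0 = let (n , v^∨) = root-coroot v-root in
      opposite-signs⇒supported {v} {n} i v^∨ (root-norm-pos v-root) (≢-sym (<⇒≢ vᵢ>0))
        λ k k≢i → nonNeg*nonPos⇒nonPos (<⇒≤ vᵢ>0) (apart≤0 k k≢i)

  image-nonneg-or-nonpos : ∀ k w → Nonneg (⟦ w ⟧ (e k)) ⊎ Nonpos (⟦ w ⟧ (e k))
  image-nonneg-or-nonpos k [] = inj₁ (e-nonNeg k)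
  image-nonneg-or-nonpos k (i ∷ w) with image-nonneg-or-nonpos k w
  ... | inj₁ ≥0 = nonneg-apart⇒sign i (i ∷ w , k , λ _ → refl) λ j j≢i →
                    subst (0ℤ ≤_) (sym (s-apart i (⟦ w ⟧ (e k)) j≢i)) (≥0 j)
  ... | inj₂ ≤0 = nonpos-apart⇒sign i (i ∷ w , k , λ _ → refl) λ j j≢i →
                    subst (_≤ 0ℤ) (sym (s-apart i (⟦ w ⟧ (e k)) j≢i)) (≤0 j)

  root-nonneg-or-nonpos : ∀ {v} → IsRoot C v → Nonneg v ⊎ Nonpos v
  root-nonneg-or-nonpos (w , k , v≗) =
    Sum.map (λ ≥0 j → subst (0ℤ ≤_) (sym (v≗ j)) (≥0 j)) (λ ≤0 j → subst (_≤ 0ℤ) (sym (v≗ j)) (≤0 j))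
            (image-nonneg-or-nonpos k w)

  supported-norm : ∀ {v} i → (∀ k → k ≢ i → v k ≡ 0ℤ) → ∀ y → ⟨ v , y ⟩ ≡ v i * ⟨ e i , y ⟩
  supported-norm {v} i apart≡0 y =
    trans (⟨⟩-by-coordinates v y) (∑-supported _ i λ k k≢i → cong (_* ⟨ e k , y ⟩) (apart≡0 k k≢i))

  supported-root : ∀ {v n} i → IsCorootOf C v n → 0ℤ < ⟨ v , v ⟩ → (∀ k → k ≢ i → v k ≡ 0ℤ) →
                   v i * n i ≡ 1ℤ
  supported-root {v} {n} i v^∨ N>0 apart≡0 = *-cancelʳ-≡ _ _ ⟨ v , v ⟩ {{>-nonZero N>0}} (begin
    v i * n i * ⟨ v , v ⟩          ≡⟨ coordinate*coroot {v} {n} i v^∨ ⟩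
    v i * v i * ⟨ e i , e i ⟩      ≡⟨ *-assoc (v i) (v i) _ ⟩
    v i * (v i * ⟨ e i , e i ⟩)    ≡⟨ cong (v i *_) (trans (⟨⟩-sym (e i) v) (supported-norm i apart≡0 (e i))) ⟨
    v i * ⟨ e i , v ⟩              ≡⟨ supported-norm i apart≡0 v ⟨
    ⟨ v , v ⟩                      ≡⟨ *-identityˡ _ ⟨
    1ℤ * ⟨ v , v ⟩                 ∎)

  supported-nonneg-root : ∀ {v n} i → IsCorootOf C v n → 0ℤ < ⟨ v , v ⟩ → Nonneg v →
                          (∀ k → k ≢ i → v k ≡ 0ℤ) → v ≗ᴸ e i × n ≗ᴸ e i
  supported-nonneg-root {v} {n} i v^∨ N>0 v≥0 apart≡0 = ≗e vᵢ≡1 apart≡0 , ≗e nᵢ≡1 coroot-apart≡0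
    where
    vᵢnᵢ≡1 : v i * n i ≡ 1ℤ
    vᵢnᵢ≡1 = supported-root {v} {n} i v^∨ N>0 apart≡0
    vᵢ≡1 : v i ≡ 1ℤ
    vᵢ≡1 = nonNeg*≡1⇒≡1 (v≥0 i) vᵢnᵢ≡1
    nᵢ≡1 : n i ≡ 1ℤ
    nᵢ≡1 = trans (sym (*-identityˡ (n i))) (trans (cong (_* n i) (sym vᵢ≡1)) vᵢnᵢ≡1)
    coroot-apart≡0 : ∀ k → k ≢ i → n k ≡ 0ℤ
    coroot-apart≡0 k k≢i = *-cancelʳ-≡ (n k) 0ℤ ⟨ v , v ⟩ {{>-nonZero N>0}}
                             (trans (v^∨ k) (cong (λ t → + 2 * t * d k) (apart≡0 k k≢i)))

  first-sign-change : ∀ {ρ} → IsRoot C ρ → Nonneg ρ → ∀ L → Nonpos (⟦ L ⟧ ρ) →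
                      ∃[ X ] ∃[ k ] ∃[ Y ] (L ≡ X ++ k ∷ Y × ⟦ Y ⟧ ρ ≗ᴸ e k)
  first-sign-change {ρ} ρ-root ρ≥0 [] ρ≤0 = ⊥-elim (<-irrefl (sym ρ-norm≡0) (root-norm-pos ρ-root))
    where
    ρ-norm≡0 : ⟨ ρ , ρ ⟩ ≡ 0ℤ
    ρ-norm≡0 = trans (⟨⟩-cong {y′ = λ _ → 0ℤ} (λ j → ≤-antisym (ρ≤0 j) (ρ≥0 j)) (λ j → ≤-antisym (ρ≤0 j) (ρ≥0 j)))
                     (∑-zero {l} λ i → ∑-zero {l} λ j → refl)
  first-sign-change {ρ} ρ-root ρ≥0 (i ∷ L) iLρ≤0 with root-nonneg-or-nonpos (root-⟦⟧ L ρ-root)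
  ... | inj₂ Lρ≤0 with first-sign-change ρ-root ρ≥0 L Lρ≤0
  ...   | X , k , Y , L≡X++kY , Yρ≗eₖ = i ∷ X , k , Y , cong (i ∷_) L≡X++kY , Yρ≗eₖ
  first-sign-change {ρ} ρ-root ρ≥0 (i ∷ L) iLρ≤0 | inj₁ Lρ≥0 =
    let (n , Lρ^∨) = root-coroot (root-⟦⟧ L ρ-root) in
    [] , i , L , refl ,
    proj₁ (supported-nonneg-root {⟦ L ⟧ ρ} {n} i Lρ^∨ (root-norm-pos (root-⟦⟧ L ρ-root)) Lρ≥0 apart≡0)
    where
    apart≡0 : ∀ k → k ≢ i → ⟦ L ⟧ ρ k ≡ 0ℤ
    apart≡0 k k≢i = ≤-antisym (subst (_≤ 0ℤ) (s-apart i (⟦ L ⟧ ρ) k≢i) (iLρ≤0 k)) (Lρ≥0 k)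

  exchange : ∀ {α m} → IsRoot C α → Nonneg α → IsCorootOf C α m → ∀ w → Nonpos (⟦ w ⟧ α) →
             ∃[ w′ ] (ℕ.suc (length w′) ≡ length w × IsWordFor w′ (λ x → ⟦ w ⟧ (reflect α m x)))
  exchange {α} {m} α-root α≥0 α^∨ w wα≤0 with first-sign-change α-root α≥0 w wα≤0
  ... | X , k , Y , refl , Yα≗eₖ = X ++ Y , shorter , spells
    where
    shorter : ℕ.suc (length (X ++ Y)) ≡ length (X ++ k ∷ Y)
    shorter = trans (cong ℕ.suc (length-++ X)) (trans (sym (ℕ.+-suc (length X) (length Y))) (sym (length-++ X)))
    spells : IsWordFor (X ++ Y) (λ x → ⟦ X ++ k ∷ Y ⟧ (reflect α m x))
    spells x j = begin
      ⟦ X ++ Y ⟧ x j                         ≡⟨ cong (λ t → t j) (⟦⟧-++ X Y x) ⟩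
      ⟦ X ⟧ (⟦ Y ⟧ x) j                      ≡⟨ ⟦⟧-cong X (s-involutive k (⟦ Y ⟧ x)) j ⟨
      ⟦ X ⟧ (s k (s k (⟦ Y ⟧ x))) j          ≡⟨ ⟦⟧-cong X (s-cong k conjugate) j ⟨
      ⟦ X ⟧ (s k (⟦ Y ⟧ (reflect α m x))) j  ≡⟨ cong (λ t → t j) (⟦⟧-++ X (k ∷ Y) (reflect α m x)) ⟨
      ⟦ X ++ k ∷ Y ⟧ (reflect α m x) j       ∎
      where
      conjugate : ⟦ Y ⟧ (reflect α m x) ≗ᴸ s k (⟦ Y ⟧ x)
      conjugate = ⟦⟧-reflect Y {α} {m} {e k} {e k} α^∨ (e-coroot k) (root-norm-pos α-root) (sym ∘ Yα≗eₖ) x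

  ∃-positive-simple-pairing : ∀ {γ} → IsRoot C γ → Nonneg γ → ∃[ k ] 0ℤ < γ ⦅ e k ⦆
  ∃-positive-simple-pairing {γ} γ-root γ≥0
    with ∑-pos⇒∃-pos _ (subst (0ℤ <_) (⟨⟩-by-coordinates γ γ) (root-norm-pos γ-root))
  ... | k , γₖ⟨eₖ,γ⟩>0 =
    k , pos*⇒pos (d-pos k) (subst (0ℤ <_) (sym (⦅e⦆*d γ k)) (nonNeg*pos⇒pos (γ≥0 k) γₖ⟨eₖ,γ⟩>0))

  ShortReflectionWord : Lat l → Lat l → Set
  ShortReflectionWord γ m = ∃[ w ] (IsWordFor w (reflect γ m) × + length w ≤ + 2 * ht C m - 1ℤ)

  short-word-by-conjugation : ∀ {γ m} k → IsCorootOf C γ m → 0ℤ < ⟨ γ , γ ⟩ → 0ℤ < γ ⦅ e k ⦆ →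
                              ShortReflectionWord (s k γ) (m +ᴸ (- e k ⦅ m ⦆) ·ᴸ e k) → ShortReflectionWord γ m
  short-word-by-conjugation {γ} {m} k γ^∨ N>0 cₖ>0 (w , w-spells , w-short) = k ∷ w ++ [ k ] , spells , short
    where
    p : ℤ
    p = e k ⦅ m ⦆
    p>0 : 0ℤ < p
    p>0 = pos*⇒pos N>0 (subst (0ℤ <_) p*N (pos*pos⇒pos {+ 2} (+<+ (ℕ.s≤s ℕ.z≤n)) (pos*pos⇒pos cₖ>0 (d-pos k))))
      where
      p*N : + 2 * (γ ⦅ e k ⦆ * d k) ≡ p * ⟨ γ , γ ⟩
      p*N = sym (trans (coroot-pairing {γ} {m} γ^∨ (e k))
                       (cong (+ 2 *_) (trans (⟨⟩-sym γ (e k)) (sym (⦅e⦆*d γ k)))))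
    spells : IsWordFor (k ∷ w ++ [ k ]) (reflect γ m)
    spells x j = begin
      s k (⟦ w ++ [ k ] ⟧ x) j                            ≡⟨ cong (λ t → s k t j) (⟦⟧-++ w [ k ] x) ⟩
      s k (⟦ w ⟧ (s k x)) j                               ≡⟨ s-cong k (w-spells (s k x)) j ⟩
      s k (reflect (s k γ) (m +ᴸ (- p) ·ᴸ e k) (s k x)) j ≡⟨ s-cong k conjugate j ⟨
      s k (s k (reflect γ m x)) j                         ≡⟨ s-involutive k (reflect γ m x) j ⟩
      reflect γ m x j                                     ∎
      where
      conjugate : s k (reflect γ m x) ≗ᴸ reflect (s k γ) (m +ᴸ (- p) ·ᴸ e k) (s k x)
      conjugate = ⟦⟧-reflect [ k ] {γ} {m} {s k γ} {m +ᴸ (- p) ·ᴸ e k} γ^∨ (s-coroot k {γ} {m} γ^∨) N>0 (λ _ → refl) x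
    ht-drop : ht C (m +ᴸ (- p) ·ᴸ e k) ≡ ht C m + (- p) * 1ℤ
    ht-drop = trans (∑-linear m (e k) (- p)) (cong (λ t → ht C m + (- p) * t) (∑-e k))
    extend : ∀ H p → + 2 * (H + (- p) * 1ℤ) - 1ℤ + + 2 * p ≡ + 2 * H - 1ℤ
    extend = solve-∀
    short : + length (k ∷ w ++ [ k ]) ≤ + 2 * ht C m - 1ℤ
    short = subst₂ _≤_ (cong +_ (trans (ℕ.+-suc (length w) 1) (cong ℕ.suc (sym (length-++ w)))))
                       (trans (cong (λ t → + 2 * t - 1ℤ + + 2 * p) ht-drop) (extend (ht C m) p))
                       (+-mono-≤ w-short (*-monoˡ-≤-nonNeg (+ 2) (i<j⇒suc[i]≤j p>0)))

  -- h bounds the height ∑ γ, which s k lowers by γ ⦅ e k ⦆ > 0.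
  short-reflection-word-below : ∀ h {γ m} → IsRoot C γ → Nonneg γ → IsCorootOf C γ m → ∑ γ < + h →
                                ShortReflectionWord γ m
  short-reflection-word-below ℕ.zero γ-root γ≥0 γ^∨ ∑γ<0 = ⊥-elim (<⇒≱ ∑γ<0 (∑-nonNeg γ≥0))
  short-reflection-word-below (ℕ.suc h) {γ} {m} γ-root γ≥0 γ^∨ ∑γ<1+h =
    by-pairing (∃-positive-simple-pairing γ-root γ≥0)
    where
    by-pairing : ∃[ k ] 0ℤ < γ ⦅ e k ⦆ → ShortReflectionWord γ m
    by-pairing (k , cₖ>0) = by-support (any? (λ j → ¬? (j ≟ k) ×-dec (0ℤ <? γ j)))
      where
      by-support : Dec (∃[ j ] (j ≢ k × 0ℤ < γ j)) → ShortReflectionWord γ m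
      by-support (no ∄j) = [ k ] , simple , length≤
        where
        apart≡0 : ∀ j → j ≢ k → γ j ≡ 0ℤ
        apart≡0 j j≢k = ≤-antisym (≮⇒≥ λ γⱼ>0 → ∄j (j , j≢k , γⱼ>0)) (γ≥0 j)
        γ≗eₖ×m≗eₖ : γ ≗ᴸ e k × m ≗ᴸ e k
        γ≗eₖ×m≗eₖ = supported-nonneg-root {γ} {m} k γ^∨ (root-norm-pos γ-root) γ≥0 apart≡0
        simple : IsWordFor [ k ] (reflect γ m)
        simple x = reflect-cong {e k} {γ} {e k} {m} {x} {x} (sym ∘ proj₁ γ≗eₖ×m≗eₖ) (sym ∘ proj₂ γ≗eₖ×m≗eₖ) (λ _ → refl)
        length≤ : + 1 ≤ + 2 * ht C m - 1ℤ
        length≤ = subst (λ t → + 1 ≤ + 2 * t - 1ℤ) (sym (trans (∑-cong (proj₂ γ≗eₖ×m≗eₖ)) (∑-e k))) ≤-refl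
      by-support (yes (j , j≢k , γⱼ>0)) =
        short-word-by-conjugation {γ} {m} k γ^∨ (root-norm-pos γ-root) cₖ>0
          (short-reflection-word-below h {s k γ} {m +ᴸ (- e k ⦅ m ⦆) ·ᴸ e k} (root-⟦⟧ [ k ] γ-root)
                                       (nonneg (root-nonneg-or-nonpos (root-⟦⟧ [ k ] γ-root))) (s-coroot k {γ} {m} γ^∨) ∑γ′<h)
        where
        nonneg : Nonneg (s k γ) ⊎ Nonpos (s k γ) → Nonneg (s k γ)
        nonneg (inj₁ ≥0) = ≥0
        nonneg (inj₂ ≤0) = ⊥-elim (<⇒≱ γⱼ>0 (subst (_≤ 0ℤ) (s-apart k γ j≢k) (≤0 j)))
        ∑γ′≡ : ∑ (s k γ) ≡ ∑ γ + - γ ⦅ e k ⦆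
        ∑γ′≡ = begin
          ∑ (s k γ)                                 ≡⟨ ∑-cong (reflect-as-sum (e k) (e k) γ) ⟩
          ∑ (γ +ᴸ (- γ ⦅ e k ⦆) ·ᴸ e k)             ≡⟨ ∑-linear γ (e k) (- γ ⦅ e k ⦆) ⟩
          ∑ γ + (- γ ⦅ e k ⦆) * ∑ (e k)             ≡⟨ cong (λ t → ∑ γ + (- γ ⦅ e k ⦆) * t) (∑-e k) ⟩
          ∑ γ + (- γ ⦅ e k ⦆) * 1ℤ                  ≡⟨ cong (_+_ (∑ γ)) (*-identityʳ (- γ ⦅ e k ⦆)) ⟩
          ∑ γ + - γ ⦅ e k ⦆                         ∎
        ∑γ′<h : ∑ (s k γ) < + h
        ∑γ′<h = subst (_< + h) (sym ∑γ′≡) (+-mono-<-≤ ∑γ<1+h (neg-mono-≤ (i<j⇒suc[i]≤j cₖ>0)))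

  short-reflection-word : ∀ {γ m} → IsRoot C γ → Nonneg γ → IsCorootOf C γ m → ShortReflectionWord γ m
  short-reflection-word {γ} γ-root γ≥0 γ^∨ =
    short-reflection-word-below (ℕ.suc ∣ ∑ γ ∣) γ-root γ≥0 γ^∨
      (subst (_< + ℕ.suc ∣ ∑ γ ∣) (0≤i⇒+∣i∣≡i (∑-nonNeg γ≥0)) (+<+ (ℕ.n<1+n _)))

  reflections-commute : ∀ {α mα β mβ} → β ⦅ mα ⦆ ≡ 0ℤ → α ⦅ mβ ⦆ ≡ 0ℤ →
                        ∀ x → reflect α mα (reflect β mβ x) ≗ᴸ reflect β mβ (reflect α mα x)
  reflections-commute {α} {mα} {β} {mβ} β⦅mα⦆≡0 α⦅mβ⦆≡0 x j = begin
    reflect β mβ x j - reflect β mβ x ⦅ mα ⦆ * α j   ≡⟨ cong (λ t → reflect β mβ x j - t * α j) (kept β mβ mα β⦅mα⦆≡0) ⟩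
    x j - x ⦅ mβ ⦆ * β j - x ⦅ mα ⦆ * α j            ≡⟨ swap (x j) (x ⦅ mβ ⦆ * β j) (x ⦅ mα ⦆ * α j) ⟩
    x j - x ⦅ mα ⦆ * α j - x ⦅ mβ ⦆ * β j            ≡⟨ cong (λ t → reflect α mα x j - t * β j) (kept α mα mβ α⦅mβ⦆≡0) ⟨
    reflect α mα x j - reflect α mα x ⦅ mβ ⦆ * β j   ∎
    where
    swap : ∀ a b c → a - b - c ≡ a - c - b
    swap = solve-∀
    vanish : ∀ a b → a + (- b) * 0ℤ ≡ a
    vanish = solve-∀
    kept : ∀ γ m h → γ ⦅ h ⦆ ≡ 0ℤ → reflect γ m x ⦅ h ⦆ ≡ x ⦅ h ⦆
    kept γ m h γ⦅h⦆≡0 = trans (reflect-pairing γ m x h)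
                              (trans (cong (λ t → x ⦅ h ⦆ + (- x ⦅ m ⦆) * t) γ⦅h⦆≡0) (vanish (x ⦅ h ⦆) (x ⦅ m ⦆)))

  shorter-word-if-negative : ∀ {α mα β mβ} wβ → IsRoot C α → Nonneg α → IsCorootOf C α mα →
                             IsRoot C β → IsCorootOf C β mβ → IsWordFor wβ (reflect β mβ) →
                             Nonpos (reflect β mβ α) →
                             ∃[ w ] (ℕ.suc (length w) ≡ length wβ × IsWordFor w (λ x → reflect α mα (reflect β mβ x)))
  shorter-word-if-negative {α} {mα} {β} {mβ} wβ α-root α≥0 α^∨ β-root β^∨ wβ-spells sβα≤0 =
    invert (exchange {α} {mα} α-root α≥0 α^∨ wβ (λ j → subst (_≤ 0ℤ) (sym (wβ-spells α j)) (sβα≤0 j)))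
    where
    sα sβ : Lat l → Lat l
    sα = reflect α mα
    sβ = reflect β mβ
    invert : ∃[ w ] (ℕ.suc (length w) ≡ length wβ × IsWordFor w (λ x → ⟦ wβ ⟧ (sα x))) →
             ∃[ w ] (ℕ.suc (length w) ≡ length wβ × IsWordFor w (λ x → sα (sβ x)))
    invert (w , shorter , w-spells) = reverse w , trans (cong ℕ.suc (length-reverse w)) shorter , spells
      where
      undoes : ∀ x → ⟦ w ⟧ (sα (sβ x)) ≗ᴸ x
      undoes x j = begin
        ⟦ w ⟧ (sα (sβ x)) j        ≡⟨ w-spells (sα (sβ x)) j ⟩
        ⟦ wβ ⟧ (sα (sα (sβ x))) j  ≡⟨ ⟦⟧-cong wβ (reflect-involutive {α} {mα} α^∨ (root-norm-pos α-root) (sβ x)) j ⟩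
        ⟦ wβ ⟧ (sβ x) j            ≡⟨ wβ-spells (sβ x) j ⟩
        sβ (sβ x) j                ≡⟨ reflect-involutive {β} {mβ} β^∨ (root-norm-pos β-root) x j ⟩
        x j                        ∎
      spells : IsWordFor (reverse w) (λ x → sα (sβ x))
      spells x j = trans (⟦⟧-cong (reverse w) (sym ∘ undoes x) j) (⟦⟧-reverse w (sα (sβ x)) j)

  shorter-word-if-positive : ∀ {α mα β mβ} wβ → IsRoot C α → IsCorootOf C α mα →
                             IsRoot C β → IsCorootOf C β mβ → IsWordFor wβ (reflect β mβ) →
                             Nonneg (reflect β mβ α) →
                             ∃[ w ] (IsWordFor w (λ x → reflect α mα (reflect β mβ x)) ×
                                     + length w ≤ + length wβ + (+ 2 * ht C (mα +ᴸ (- β ⦅ mα ⦆) ·ᴸ mβ) - 1ℤ))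
  shorter-word-if-positive {α} {mα} {β} {mβ} wβ α-root α^∨ β-root β^∨ wβ-spells sβα≥0 =
    extend (short-reflection-word γ-root sβα≥0 γ^∨)
    where
    γ mγ : Lat l
    γ = reflect β mβ α
    mγ = mα +ᴸ (- β ⦅ mα ⦆) ·ᴸ mβ
    γ-root : IsRoot C γ
    γ-root = root-cong {⟦ wβ ⟧ α} {reflect β mβ α} (wβ-spells α) (root-⟦⟧ wβ α-root)
    γ^∨ : IsCorootOf C γ mγ
    γ^∨ = reflect-coroot {β} {mβ} β^∨ (root-norm-pos β-root) {α} {mα} α^∨
    wβγ≗α : α ≗ᴸ ⟦ wβ ⟧ γ
    wβγ≗α j = sym (trans (wβ-spells γ j) (reflect-involutive {β} {mβ} β^∨ (root-norm-pos β-root) α j))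
    extend : ShortReflectionWord γ mγ →
             ∃[ w ] (IsWordFor w (λ x → reflect α mα (reflect β mβ x)) × + length w ≤ + length wβ + (+ 2 * ht C mγ - 1ℤ))
    extend (wγ , wγ-spells , wγ-short) = wβ ++ wγ , spells , length≤
      where
      spells : IsWordFor (wβ ++ wγ) (λ x → reflect α mα (reflect β mβ x))
      spells x j = begin
        ⟦ wβ ++ wγ ⟧ x j                    ≡⟨ cong (λ t → t j) (⟦⟧-++ wβ wγ x) ⟩
        ⟦ wβ ⟧ (⟦ wγ ⟧ x) j                 ≡⟨ ⟦⟧-cong wβ (wγ-spells x) j ⟩
        ⟦ wβ ⟧ (reflect γ mγ x) j           ≡⟨ ⟦⟧-reflect wβ {γ} {mγ} {α} {mα} γ^∨ α^∨ (root-norm-pos γ-root) wβγ≗α x j ⟩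
        reflect α mα (⟦ wβ ⟧ x) j           ≡⟨ reflect-cong {α} {α} {mα} {mα} (λ _ → refl) (λ _ → refl) (wβ-spells x) j ⟩
        reflect α mα (reflect β mβ x) j     ∎
      length≤ : + length (wβ ++ wγ) ≤ + length wβ + (+ 2 * ht C mγ - 1ℤ)
      length≤ = subst (_≤ + length wβ + (+ 2 * ht C mγ - 1ℤ)) (cong +_ (sym (length-++ wβ)))
                      (+-monoʳ-≤ (+ length wβ) wγ-short)

  shorter-word : ∀ {α mα β mβ a} wβ → IsRoot C α → Nonneg α → IsCorootOf C α mα → + a ≡ + 2 * ht C mα - 1ℤ →
                 IsRoot C β → IsCorootOf C β mβ → IsWordFor wβ (reflect β mβ) →
                 + length wβ ≡ + 2 * ht C mβ - 1ℤ → 0ℤ < α ⦅ mβ ⦆ →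
                 ∃[ w ] (IsWordFor w (λ x → reflect α mα (reflect β mβ x)) × length w ℕ.< a ℕ.+ length wβ)
  shorter-word {α} {mα} {β} {mβ} {a} wβ α-root α≥0 α^∨ a≡ β-root β^∨ wβ-spells |wβ|≡ p>0 =
    by-sign (root-nonneg-or-nonpos (root-cong {⟦ wβ ⟧ α} {reflect β mβ α} (wβ-spells α) (root-⟦⟧ wβ α-root)))
    where
    Shorter : Set
    Shorter = ∃[ w ] (IsWordFor w (λ x → reflect α mα (reflect β mβ x)) × length w ℕ.< a ℕ.+ length wβ)
    q Hβ : ℤ
    q = β ⦅ mα ⦆
    Hβ = ht C mβ
    q>0 : 0ℤ < q
    q>0 = pos*⇒pos (root-norm-pos α-root)
            (subst (0ℤ <_) (sym (pairing-sym {α} {mα} {β} {mβ} α^∨ β^∨)) (pos*pos⇒pos p>0 (root-norm-pos β-root)))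
    drop>0 : 0ℤ < + 2 * (q * Hβ)
    drop>0 = pos*pos⇒pos {+ 2} (+<+ (ℕ.s≤s ℕ.z≤n)) (pos*pos⇒pos q>0 (+n≡2i-1⇒0<i |wβ|≡))
    regroup : ∀ L Hα q Hβ → L + (+ 2 * (Hα + (- q) * Hβ) - 1ℤ) ≡ L + (+ 2 * Hα - 1ℤ) - + 2 * (q * Hβ)
    regroup = solve-∀
    bound-rewrite : + length wβ + (+ 2 * ht C (mα +ᴸ (- q) ·ᴸ mβ) - 1ℤ) ≡ + length wβ + + a - + 2 * (q * Hβ)
    bound-rewrite = begin
      + length wβ + (+ 2 * ht C (mα +ᴸ (- q) ·ᴸ mβ) - 1ℤ)      ≡⟨ cong (λ t → + length wβ + (+ 2 * t - 1ℤ)) (∑-linear mα mβ (- q)) ⟩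
      + length wβ + (+ 2 * (ht C mα + (- q) * Hβ) - 1ℤ)        ≡⟨ regroup (+ length wβ) (ht C mα) q Hβ ⟩
      + length wβ + (+ 2 * ht C mα - 1ℤ) - + 2 * (q * Hβ)      ≡⟨ cong (λ t → + length wβ + t - + 2 * (q * Hβ)) a≡ ⟨
      + length wβ + + a - + 2 * (q * Hβ)                       ∎
    from-positive : ∃[ w ] (IsWordFor w (λ x → reflect α mα (reflect β mβ x)) ×
                            + length w ≤ + length wβ + (+ 2 * ht C (mα +ᴸ (- q) ·ᴸ mβ) - 1ℤ)) → Shorter
    from-positive (w , w-spells , |w|≤) =
      w , w-spells , subst (length w ℕ.<_) (ℕ.+-comm (length wβ) a)
                           (drop‿+≤+ (i<j⇒suc[i]≤j (i≤j-k⇒i<j (subst (+ length w ≤_) bound-rewrite |w|≤) drop>0)))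
    from-negative : ∃[ w ] (ℕ.suc (length w) ≡ length wβ × IsWordFor w (λ x → reflect α mα (reflect β mβ x))) →
                    Shorter
    from-negative (w , 1+|w|≡|wβ| , w-spells) =
      w , w-spells , ℕ.≤-trans (ℕ.≤-reflexive 1+|w|≡|wβ|) (ℕ.m≤n+m (length wβ) a)
    by-sign : Nonneg (reflect β mβ α) ⊎ Nonpos (reflect β mβ α) → Shorter
    by-sign (inj₁ sβα≥0) =
      from-positive (shorter-word-if-positive {α} {mα} {β} {mβ} wβ α-root α^∨ β-root β^∨ wβ-spells sβα≥0)
    by-sign (inj₂ sβα≤0) =
      from-negative (shorter-word-if-negative {α} {mα} {β} {mβ} wβ α-root α≥0 α^∨ β-root β^∨ wβ-spells sβα≤0)

lemma3p2 : ∀ {l : ℕ} (C : CartanDatum l) (α β mα mβ : Lat l) →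
    InTildePos C α mα → InTildePos C β mβ →
    (∃[ a ] ∃[ b ] ∃[ c ] (HasLength C (D.refl C α mα) a × HasLength C (D.refl C β mβ) b ×
       HasLength C (λ x → D.refl C α mα (D.refl C β mβ x)) c × c ≡ a ℕ.+ b)) →
    ¬ (∀ x → _≗ᴸ_ (D.refl C α mα (D.refl C β mβ x)) (D.refl C β mβ (D.refl C α mα x))) →
    pair C α mβ < + 0
lemma3p2 C α β mα mβ ((α-root , α≥0) , α^∨ , kα , ℓα , kα≡) ((β-root , _) , β^∨ , kβ , ℓβ , kβ≡)
         (a , b , c , ℓa , ℓb@((wβ , |wβ|≡b , wβ-spells) , _) , (_ , c-minimal) , c≡a+b) noncommuting =
  by-sign (<-cmp (pair C α mβ) 0ℤ)
  where
  a≡ : + a ≡ + 2 * ht C mα - 1ℤ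
  a≡ = trans (cong +_ (HasLength-unique C ℓa ℓα)) kα≡
  |wβ|≡ : + length wβ ≡ + 2 * ht C mβ - 1ℤ
  |wβ|≡ = trans (cong +_ (trans |wβ|≡b (HasLength-unique C ℓb ℓβ))) kβ≡
  by-sign : Tri (pair C α mβ < 0ℤ) (pair C α mβ ≡ 0ℤ) (pair C α mβ > 0ℤ) → pair C α mβ < + 0
  by-sign (tri< p<0 _ _) = p<0
  by-sign (tri≈ _ p≡0 _) = ⊥-elim (noncommuting (reflections-commute C {α} {mα} {β} {mβ} q≡0 p≡0))
    where
    q≡0 : pair C β mα ≡ 0ℤ
    q≡0 = pairing-zero-sym C {α} {mα} {β} {mβ} α^∨ β^∨ (root-norm-pos C α-root) p≡0
  by-sign (tri> _ _ p>0) =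
    let (w , w-spells , |w|<a+|wβ|) = shorter-word C {α} {mα} {β} {mβ} {a} wβ α-root α≥0 α^∨ a≡ β-root β^∨ wβ-spells |wβ|≡ p>0
    in ⊥-elim (ℕ.<⇒≱ (subst (length w ℕ.<_) (trans (cong (a ℕ.+_) |wβ|≡b) (sym c≡a+b)) |w|<a+|wβ|)
                     (c-minimal w w-spells))
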